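{- For every positive integer $k$, there exists a tree $T$ with maximum degree $\Delta(T)=k$ and $C_2(T)=k+1$.
   Context: All graphs are finite, simple and undirected. A set $S\subseteq V(G)$ is a $2$-dominating set of $G$ if every vertex of $V(G)\setminus S$ has at least $2$ neighbours in $S$. Two sets $U_1,U_2\subseteq V(G)$ form a $2$-coalition if neither $U_1$ nor $U_2$ is a $2$-dominating set of $G$, but $U_1\cup U_2$ is. A $2$-coalition partition of $G$ is a partition $\Theta$ of $V(G)$ into nonempty sets such that every set of $\Theta$ either is a $2$-dominating set of $G$ with exactly $2$ elements, or forms a $2$-coalition with some other set of $\Theta$. The $2$-coalition number $C_2(G)$ is the maximum number of sets in a $2$-coalition partition of $G$. -}

module Defs where

open import Data.Nat using (ℕ; zero; suc; _≤_; _⊔_)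
open import Data.Fin using (Fin)
open import Data.Fin.Properties using () renaming (_≟_ to _≟F_)
open import Data.Fin.Subset using (Subset; _∈_; _∉_; _∩_; _∪_; ∣_∣)
open import Data.Bool using (Bool; true; false; T)
open import Data.Vec using (tabulate)
open import Data.List using (List; []; _∷_; length; foldr; map; allFin)
open import Data.List.Relation.Unary.Unique.Propositional using (Unique)
open import Data.List.Relation.Unary.Linked using (Linked)
open import Data.List.Membership.Propositional using () renaming (_∈_ to _∈ₗ_)
open import Data.Product using (Σ; ∃; _×_)
open import Data.Sum using (_⊎_)
open import Relation.Nullary using (¬_; ⌊_⌋)
open import Relation.Binary.PropositionalEquality using (_≡_; _≢_)
open import Function using (Surjective)

record Graph : Set where
  field
    n     : ℕ
    adj   : Fin n → Fin n → Bool
    sym   : ∀ u v → adj u v ≡ adj v u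
    irrefl : ∀ v → adj v v ≡ false
open Graph public

Adj : (G : Graph) → Fin (n G) → Fin (n G) → Set
Adj G u v = T (adj G u v)

N : (G : Graph) → Fin (n G) → Subset (n G)
N G v = tabulate (adj G v)

degree : (G : Graph) → Fin (n G) → ℕ
degree G v = ∣ N G v ∣

-- Maximum degree Δ(G) (0 for the empty graph).
maxDegree : (G : Graph) → ℕ
maxDegree G = foldr _⊔_ 0 (map (degree G) (allFin (n G)))

data Walk (G : Graph) : Fin (n G) → Fin (n G) → Set where
  here : ∀ v → Walk G v v
  step : ∀ {u w v} → Adj G u w → Walk G w v → Walk G u v

Connected : Graph → Set
Connected G = ∀ u v → Walk G u v

lastV : {A : Set} → A → List A → A
lastV x [] = x
lastV x (y ∷ ys) = lastV y ys

record Cycle (G : Graph) : Set where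
  field
    first    : Fin (n G)
    rest     : List (Fin (n G))
    long     : 3 ≤ length (first ∷ rest)
    distinct : Unique (first ∷ rest)
    path     : Linked (Adj G) (first ∷ rest)
    closes   : Adj G (lastV first rest) first

Acyclic : Graph → Set
Acyclic G = ¬ Cycle G

IsTree : Graph → Set
IsTree G = (1 ≤ n G) × Connected G × Acyclic G

TwoDominating : (G : Graph) → Subset (n G) → Set
TwoDominating G S = ∀ v → v ∉ S → 2 ≤ ∣ S ∩ N G v ∣

TwoCoalition : (G : Graph) → Subset (n G) → Subset (n G) → Set
TwoCoalition G U₁ U₂ =
  ¬ TwoDominating G U₁ × ¬ TwoDominating G U₂ × TwoDominating G (U₁ ∪ U₂)

-- A partition of V(G) into m nonempty sets, given by a surjective labelling
-- f : V(G) → Fin m; the i-th set is the fibre f⁻¹(i).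
cls : (G : Graph) {m : ℕ} → (Fin (n G) → Fin m) → Fin m → Subset (n G)
cls G f i = tabulate (λ v → ⌊ f v ≟F i ⌋)

IsTwoCoalitionPartition : (G : Graph) (m : ℕ) → (Fin (n G) → Fin m) → Set
IsTwoCoalitionPartition G m f =
  Surjective _≡_ _≡_ f ×
  (∀ i → (TwoDominating G (cls G f i) × ∣ cls G f i ∣ ≡ 2)
         ⊎ (Σ (Fin m) λ j → j ≢ i × TwoCoalition G (cls G f i) (cls G f j)))

HasTwoCoalitionPartition : Graph → ℕ → Set
HasTwoCoalitionPartition G m = Σ (Fin (n G) → Fin m) (IsTwoCoalitionPartition G m)

C₂≡ : Graph → ℕ → Set
C₂≡ G m = HasTwoCoalitionPartition G m × (∀ m′ → HasTwoCoalitionPartition G m′ → m′ ≤ m)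

-- A leaf ℓ lies in every 2-dominating set.  So in a 2-coalition partition either the class X
-- of ℓ is 2-dominating, and then it is the only class, or every other class forms its
-- coalition with X.  In the second case take w ∉ X with at most one neighbour in X, and a
-- neighbour z of w that is this X-neighbour if there is one.  Every class C other than X and
-- the class of w 2-dominates w together with X, so w has a neighbour in C other than z; hence
-- there are at most 2 + (deg w − 1) ≤ Δ + 1 classes.  For Δ = k ≠ 2 the bound is attained by
-- the spider whose centre carries a pendant vertex and k − 1 spokes ending in two leaves each:
-- the pendant vertex and the leaves form one class, the centre and every spoke a singleton
-- class, each partnering the first.  For k = 2 the path P₄ does the same.

module Submission where

open import Defs renaming (sym to adj-sym)
open import Data.Nat using (ℕ; zero; suc; _≤_; _<_; _⊔_; z≤n; s≤s; _+_; _≤?_)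
open import Data.Nat.Properties
  using (≤-refl; ≤-trans; ≤-antisym; ≤-reflexive; ≤-pred; n≤1+n; 1+n≰n; ≰⇒>; ⊔-lub; m≤n⇒m≤n⊔o;
         m≤n⇒m≤o⊔n; +-monoʳ-≤; +-comm; module ≤-Reasoning)
open import Data.Fin using (Fin; zero; suc; splitAt; _↑ˡ_; _↑ʳ_)
open import Data.Fin.Properties
  using (any?; all?; ¬∀⟶∃¬; splitAt-↑ˡ; splitAt-↑ʳ; splitAt⁻¹-↑ˡ; splitAt⁻¹-↑ʳ) renaming (_≟_ to _≟F_)
open import Data.Fin.Subset using (Subset; _∈_; _∉_; _∩_; _∪_; _⊆_; ∣_∣; _-_; ⁅_⁆; ⊤; ⊥)
open import Data.Fin.Subset.Properties
  using (_∈?_; p─⊥≡p; p─q⊆p; x∈p∧x≢y⇒x∈p-y; x∈p⇒∣p-x∣<∣p∣; ∣⊤∣≡n; p⊆q⇒∣p∣≤∣q∣; ∣⁅x⁆∣≡1; ∣⊥∣≡0;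
         x∈⁅y⁆⇒x≡y; x∈⁅x⁆; x∈p∩q⁺; x∈p∩q⁻; x∈p∪q⁺; x∈p∪q⁻; ∣p∩q∣≤∣q∣; ∣p─q∣≤∣p∣; ∪-comm)
open import Data.Bool using (Bool; true; false; T; _∨_)
open import Data.Bool.Properties using (T-≡; T-∨; ∨-comm)
open import Data.Vec using (_∷_; tabulate; here; there)
open import Data.Vec.Properties using ([]=⇒lookup; lookup⇒[]=; lookup∘tabulate)
open import Data.List using (List; []; _∷_; length; [_]; _++_; _∷ʳ_; map; filter; allFin)
open import Data.List.Properties
  using (++-assoc; length-++; length-map; length-tabulate; foldr-preservesᵇ; foldr-preservesᵒ)
open import Data.List.Membership.Propositional using () renaming (_∈_ to _∈ₗ_)
open import Data.List.Membership.Propositional.Properties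
  using (∈-∃++; ∈-++⁺ˡ; ∈-++⁺ʳ; ∈-map⁺; ∈-filter⁺; ∈-filter⁻; ∈-allFin)
open import Data.List.Relation.Unary.All using (All; []; _∷_)
import Data.List.Relation.Unary.All as All
import Data.List.Relation.Unary.All.Properties as All
open import Data.List.Relation.Unary.AllPairs using ([]; _∷_)
open import Data.List.Relation.Unary.Any using (here; there)
import Data.List.Relation.Unary.Any as Any
open import Data.List.Relation.Unary.Linked using (Linked; [-]; _∷_)
open import Data.List.Relation.Unary.Unique.Propositional using (Unique)
open import Data.List.Relation.Unary.Unique.Propositional.Properties
  using (filter⁺; allFin⁺; ++⁺) renaming (map⁺ to Unique-map⁺)
open import Data.Product using (Σ; ∃; _×_; _,_; proj₂)
open import Data.Sum using (_⊎_; inj₁; inj₂; [_,_]′)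
open import Data.Empty using (⊥-elim)
open import Function using (_∘_; case_of_; Surjective)
open import Function.Bundles using (Equivalence)
open import Relation.Nullary using (¬_; Dec; yes; no; ⌊_⌋)
open import Relation.Nullary.Decidable using (True; ¬?; _×-dec_; _→-dec_; toWitness; fromWitness)
open import Relation.Binary.PropositionalEquality
  using (_≡_; _≢_; refl; sym; trans; cong; cong₂; subst; subst₂)

∈-tabulate⁺ : ∀ {k} (p : Fin k → Bool) {x} → T (p x) → x ∈ tabulate p
∈-tabulate⁺ p {x} px = lookup⇒[]= x (tabulate p) (trans (lookup∘tabulate p x) (Equivalence.to T-≡ px))

∈-tabulate⁻ : ∀ {k} (p : Fin k → Bool) {x} → x ∈ tabulate p → T (p x)
∈-tabulate⁻ p {x} x∈ = Equivalence.from T-≡ (trans (sym (lookup∘tabulate p x)) ([]=⇒lookup x∈))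

x∉p-x : ∀ {k} (p : Subset k) x → x ∉ p - x
x∉p-x (_ ∷ p) zero ()
x∉p-x (_ ∷ p) (suc x) (there x∈) = x∉p-x p x x∈

∣p∣≤1+∣p-x∣ : ∀ {k} (p : Subset k) x → ∣ p ∣ ≤ suc ∣ p - x ∣
∣p∣≤1+∣p-x∣ (s ∷ p) zero =
  subst (λ q → ∣ s ∷ p ∣ ≤ suc ∣ q ∣) (sym (p─⊥≡p p)) (∣s∷p∣≤1+∣p∣ s)
  where
  ∣s∷p∣≤1+∣p∣ : ∀ s → ∣ s ∷ p ∣ ≤ suc ∣ p ∣
  ∣s∷p∣≤1+∣p∣ true = ≤-refl
  ∣s∷p∣≤1+∣p∣ false = n≤1+n _
∣p∣≤1+∣p-x∣ (true ∷ p) (suc x) = s≤s (∣p∣≤1+∣p-x∣ p x)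
∣p∣≤1+∣p-x∣ (false ∷ p) (suc x) = ∣p∣≤1+∣p-x∣ p x

∣p∣≤length : ∀ {k} (p : Subset k) (xs : List (Fin k)) → (∀ {v} → v ∈ p → v ∈ₗ xs) → ∣ p ∣ ≤ length xs
∣p∣≤length {k} p [] p⊆[] =
  subst (∣ p ∣ ≤_) (∣⊥∣≡0 k) (p⊆q⇒∣p∣≤∣q∣ {q = ⊥} (λ v∈p → case p⊆[] v∈p of λ ()))
∣p∣≤length p (x ∷ xs) p⊆xs = ≤-trans (∣p∣≤1+∣p-x∣ p x) (s≤s (∣p∣≤length (p - x) xs p-x⊆xs))
  where
  p-x⊆xs : ∀ {v} → v ∈ p - x → v ∈ₗ xs
  p-x⊆xs {v} v∈ with p⊆xs (p─q⊆p p ⁅ x ⁆ v∈)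
  ... | here refl = ⊥-elim (x∉p-x p x v∈)
  ... | there v∈xs = v∈xs

length≤∣p∣ : ∀ {k} (p : Subset k) (xs : List (Fin k)) → Unique xs → All (_∈ p) xs → length xs ≤ ∣ p ∣
length≤∣p∣ p [] _ _ = z≤n
length≤∣p∣ p (x ∷ xs) (x∉xs ∷ xs!) (x∈p ∷ xs⊆p) =
  ≤-trans (s≤s (length≤∣p∣ (p - x) xs xs! xs⊆p-x)) (x∈p⇒∣p-x∣<∣p∣ x∈p)
  where
  xs⊆p-x : All (_∈ p - x) xs
  xs⊆p-x = All.zipWith (λ (v∈p , x≢v) → x∈p∧x≢y⇒x∈p-y v∈p (x≢v ∘ sym)) (xs⊆p , x∉xs)

x≢y⇒2≤∣p∣ : ∀ {k} {p : Subset k} {x y} → x ≢ y → x ∈ p → y ∈ p → 2 ≤ ∣ p ∣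
x≢y⇒2≤∣p∣ {p = p} x≢y x∈p y∈p =
  length≤∣p∣ p (_ ∷ _ ∷ []) ((x≢y ∷ []) ∷ [] ∷ []) (x∈p ∷ y∈p ∷ [])

⊆⁅x⁆⇒∣p∣≤1 : ∀ {k} {p : Subset k} {x} → p ⊆ ⁅ x ⁆ → ∣ p ∣ ≤ 1
⊆⁅x⁆⇒∣p∣≤1 {x = x} p⊆x = subst (_ ≤_) (∣⁅x⁆∣≡1 x) (p⊆q⇒∣p∣≤∣q∣ p⊆x)

2≤∣p∣⇒∃≢ : ∀ {k} {p : Subset k} → 2 ≤ ∣ p ∣ → ∀ z → ∃ λ v → v ∈ p × v ≢ z
2≤∣p∣⇒∃≢ {p = p} 2≤∣p∣ z with any? (λ v → (v ∈? p) ×-dec ¬? (v ≟F z))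
... | yes found = found
... | no none = ⊥-elim (1+n≰n (≤-trans 2≤∣p∣ (⊆⁅x⁆⇒∣p∣≤1 p⊆z)))
  where
  p⊆z : p ⊆ ⁅ z ⁆
  p⊆z {v} v∈p with v ≟F z
  ... | yes refl = x∈⁅x⁆ z
  ... | no v≢z = ⊥-elim (none (v , v∈p , v≢z))

∣p∣≤1⇒≡ : ∀ {k} {p : Subset k} → ∣ p ∣ ≤ 1 → ∀ {x y} → x ∈ p → y ∈ p → x ≡ y
∣p∣≤1⇒≡ ∣p∣≤1 {x} {y} x∈p y∈p with x ≟F y
... | yes x≡y = x≡y
... | no x≢y = ⊥-elim (1+n≰n (≤-trans (x≢y⇒2≤∣p∣ x≢y x∈p y∈p) ∣p∣≤1))

≤length : ∀ {m} (xs : List (Fin m)) → (∀ i → i ∈ₗ xs) → m ≤ length xs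
≤length {m} xs complete = subst (_≤ length xs) (∣⊤∣≡n m) (∣p∣≤length ⊤ xs (λ {i} _ → complete i))

≤length+∣p∣ : ∀ {k m} (f : Fin k → Fin m) (p : Subset k) (xs : List (Fin m)) →
              (∀ i → i ∈ₗ xs ⊎ ∃ λ v → v ∈ p × f v ≡ i) → m ≤ length xs + ∣ p ∣
≤length+∣p∣ {k} f p xs covered = begin
  _                           ≤⟨ ≤length (xs ++ map f vs) complete ⟩
  length (xs ++ map f vs)     ≡⟨ length-++ xs ⟩
  length xs + length (map f vs) ≡⟨ cong (length xs +_) (length-map f vs) ⟩
  length xs + length vs       ≤⟨ +-monoʳ-≤ (length xs) (length≤∣p∣ p vs vs! vs⊆p) ⟩
  length xs + ∣ p ∣           ∎
  where
  open ≤-Reasoning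
  vs = filter (_∈? p) (allFin k)
  vs! : Unique vs
  vs! = filter⁺ (_∈? p) (allFin⁺ k)
  vs⊆p : All (_∈ p) vs
  vs⊆p = All.tabulate (λ v∈vs → proj₂ (∈-filter⁻ (_∈? p) {xs = allFin k} v∈vs))
  complete : ∀ i → i ∈ₗ xs ++ map f vs
  complete i with covered i
  ... | inj₁ i∈xs = ∈-++⁺ˡ i∈xs
  ... | inj₂ (v , v∈p , refl) = ∈-++⁺ʳ xs (∈-map⁺ f (∈-filter⁺ (_∈? p) (∈-allFin v) v∈p))

module _ (G : Graph) where

  Adj-sym : ∀ {u v} → Adj G u v → Adj G v u
  Adj-sym {u} {v} = subst T (adj-sym G u v)

  Adj⇒∈N : ∀ {u v} → Adj G u v → v ∈ N G u
  Adj⇒∈N = ∈-tabulate⁺ (adj G _)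

  ∈N⇒Adj : ∀ {u v} → v ∈ N G u → Adj G u v
  ∈N⇒Adj = ∈-tabulate⁻ (adj G _)

  degree≤maxDegree : ∀ v → degree G v ≤ maxDegree G
  degree≤maxDegree v =
    foldr-preservesᵒ {P = degree G v ≤_} (λ x y → [ m≤n⇒m≤n⊔o y , m≤n⇒m≤o⊔n x ]′) 0 _
    (inj₂ (Any.map (λ { refl → ≤-refl }) (∈-map⁺ (degree G) (∈-allFin v))))

  maxDegree≤ : ∀ {b} → (∀ v → degree G v ≤ b) → maxDegree G ≤ b
  maxDegree≤ {b} degree≤b =
    foldr-preservesᵇ {P = _≤ b} {f = _⊔_} ⊔-lub {xs = map (degree G) (allFin (n G))} z≤n
      (All.map⁺ (All.tabulate (λ {v} _ → degree≤b v)))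

  TwoDominatedAt? : ∀ S v → Dec (v ∉ S → 2 ≤ ∣ S ∩ N G v ∣)
  TwoDominatedAt? S v = ¬? (v ∈? S) →-dec (2 ≤? ∣ S ∩ N G v ∣)

  TwoDominating? : ∀ S → Dec (TwoDominating G S)
  TwoDominating? S = all? (TwoDominatedAt? S)

  TwoCoalition? : ∀ A B → Dec (TwoCoalition G A B)
  TwoCoalition? A B = ¬? (TwoDominating? A) ×-dec ¬? (TwoDominating? B) ×-dec TwoDominating? (A ∪ B)

  TwoDominating-by-neighbours : ∀ S →
    (∀ v → v ∉ S → ∃ λ a → ∃ λ b → a ≢ b × a ∈ S × b ∈ S × Adj G v a × Adj G v b) →
    TwoDominating G S
  TwoDominating-by-neighbours S neighbours v v∉S with neighbours v v∉S
  ... | a , b , a≢b , a∈S , b∈S , v~a , v~b =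
    x≢y⇒2≤∣p∣ a≢b (x∈p∩q⁺ (a∈S , Adj⇒∈N v~a)) (x∈p∩q⁺ (b∈S , Adj⇒∈N v~b))

  ¬TwoDominating⇒∃ : ∀ {S} → ¬ TwoDominating G S → ∃ λ w → w ∉ S × ∣ S ∩ N G w ∣ ≤ 1
  ¬TwoDominating⇒∃ {S} ¬dom with ¬∀⟶∃¬ (n G) _ (TwoDominatedAt? S) ¬dom
  ... | w , ¬dom-w =
    w , (λ w∈S → ¬dom-w (λ w∉S → ⊥-elim (w∉S w∈S))) , ≤-pred (≰⇒> (λ 2≤ → ¬dom-w (λ _ → 2≤)))

  leaf∈TwoDominating : ∀ {ℓ S} → degree G ℓ ≤ 1 → TwoDominating G S → ℓ ∈ S
  leaf∈TwoDominating {ℓ} {S} leaf dom with ℓ ∈? S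
  ... | yes ℓ∈S = ℓ∈S
  ... | no ℓ∉S = ⊥-elim (1+n≰n (≤-trans (dom ℓ ℓ∉S) (≤-trans (∣p∩q∣≤∣q∣ S (N G ℓ)) leaf)))

  pivot-neighbour : ∀ {X w} → ∣ X ∩ N G w ∣ ≤ 1 →
    ∃ λ z → X ∩ N G w ⊆ ⁅ z ⁆ × suc ∣ N G w - z ∣ ≤ degree G w ⊔ 1
  pivot-neighbour {X} {w} sparse with any? (_∈? X ∩ N G w)
  ... | yes (x , x∈) = x , (λ v∈ → subst (_∈ ⁅ x ⁆) (∣p∣≤1⇒≡ sparse x∈ v∈) (x∈⁅x⁆ x)) ,
                        m≤n⇒m≤n⊔o 1 (x∈p⇒∣p-x∣<∣p∣ (proj₂ (x∈p∩q⁻ X (N G w) x∈)))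
  ... | no ∄x with any? (_∈? N G w)
  ...   | yes (y , y∈) = y , (λ v∈ → ⊥-elim (∄x (_ , v∈))) , m≤n⇒m≤n⊔o 1 (x∈p⇒∣p-x∣<∣p∣ y∈)
  ...   | no ∄y = w , (λ v∈ → ⊥-elim (∄x (_ , v∈))) , m≤n⇒m≤o⊔n (degree G w) (s≤s ∣N-w∣≤0)
    where
    ∣N-w∣≤0 : ∣ N G w - w ∣ ≤ 0
    ∣N-w∣≤0 =
      ≤-trans (∣p─q∣≤∣p∣ (N G w) ⁅ w ⁆) (∣p∣≤length (N G w) [] (λ v∈ → ⊥-elim (∄y (_ , v∈))))

  module _ {m} (f : Fin (n G) → Fin m) where

    ∈cls⁺ : ∀ {v i} → f v ≡ i → v ∈ cls G f i
    ∈cls⁺ fv≡i = ∈-tabulate⁺ _ (fromWitness fv≡i)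

    ∈cls⁻ : ∀ {v i} → v ∈ cls G f i → f v ≡ i
    ∈cls⁻ v∈ = toWitness (∈-tabulate⁻ _ v∈)

    Partnered : Fin m → Set
    Partnered i = Σ (Fin m) λ j → j ≢ i × TwoCoalition G (cls G f i) (cls G f j)

    partnered⇒partition : Surjective _≡_ _≡_ f → (∀ i → Partnered i) → IsTwoCoalitionPartition G m f
    partnered⇒partition surjective partner = surjective , λ i → inj₂ (partner i)

-- The upper bound Δ + 1

module _ (G : Graph) {ℓ : Fin (n G)} (leaf : degree G ℓ ≤ 1) {m} {f : Fin (n G) → Fin m}
         (partition : IsTwoCoalitionPartition G m f) where

  private
    X = cls G f (f ℓ)

  leaf-class-or-coalition : ∀ i → f ℓ ≡ i ⊎ TwoCoalition G (cls G f i) X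
  leaf-class-or-coalition i with proj₂ partition i
  ... | inj₁ (dom , _) = inj₁ (∈cls⁻ G f (leaf∈TwoDominating G leaf dom))
  ... | inj₂ (j , _ , coalition@(_ , _ , dom∪))
    with x∈p∪q⁻ (cls G f i) (cls G f j) (leaf∈TwoDominating G leaf dom∪)
  ...   | inj₁ ℓ∈i = inj₁ (∈cls⁻ G f ℓ∈i)
  ...   | inj₂ ℓ∈j =
    inj₂ (subst (λ j → TwoCoalition G (cls G f i) (cls G f j)) (sym (∈cls⁻ G f ℓ∈j)) coalition)

  TwoDominating-leaf-class⇒m≤1 : TwoDominating G X → m ≤ 1
  TwoDominating-leaf-class⇒m≤1 domX = ≤length [ f ℓ ] only-leaf-class
    where
    only-leaf-class : ∀ i → i ∈ₗ [ f ℓ ]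
    only-leaf-class i with leaf-class-or-coalition i
    ... | inj₁ fℓ≡i = here (sym fℓ≡i)
    ... | inj₂ (_ , ¬domX , _) = ⊥-elim (¬domX domX)

  module _ {w} (w∉X : w ∉ X) where

    other-class-neighbour : ∀ {z} → X ∩ N G w ⊆ ⁅ z ⁆ →
      ∀ i → i ≢ f ℓ → i ≢ f w → ∃ λ v → v ∈ N G w - z × f v ≡ i
    other-class-neighbour {z} X∩Nw⊆z i i≢fℓ i≢fw with leaf-class-or-coalition i
    ... | inj₁ fℓ≡i = ⊥-elim (i≢fℓ (sym fℓ≡i))
    ... | inj₂ (_ , _ , dom∪) with 2≤∣p∣⇒∃≢ (dom∪ w w∉i∪X) z
      where
      w∉i∪X : w ∉ cls G f i ∪ X
      w∉i∪X w∈ with x∈p∪q⁻ (cls G f i) X w∈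
      ... | inj₁ w∈i = i≢fw (sym (∈cls⁻ G f w∈i))
      ... | inj₂ w∈X = w∉X w∈X
    ... | v , v∈ , v≢z with x∈p∩q⁻ (cls G f i ∪ X) (N G w) v∈
    ...   | v∈i∪X , v∈Nw with x∈p∪q⁻ (cls G f i) X v∈i∪X
    ...     | inj₁ v∈i = v , x∈p∧x≢y⇒x∈p-y v∈Nw v≢z , ∈cls⁻ G f v∈i
    ...     | inj₂ v∈X = ⊥-elim (v≢z (x∈⁅y⁆⇒x≡y z (X∩Nw⊆z (x∈p∩q⁺ (v∈X , v∈Nw)))))

    m≤2+∣N-z∣ : ∀ {z} → X ∩ N G w ⊆ ⁅ z ⁆ → m ≤ 2 + ∣ N G w - z ∣
    m≤2+∣N-z∣ X∩Nw⊆z = ≤length+∣p∣ f (N G w - _) (f ℓ ∷ f w ∷ []) covered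
      where
      covered : ∀ i → i ∈ₗ f ℓ ∷ f w ∷ [] ⊎ ∃ λ v → v ∈ N G w - _ × f v ≡ i
      covered i with i ≟F f ℓ | i ≟F f w
      ... | yes i≡fℓ | _ = inj₁ (here i≡fℓ)
      ... | no _ | yes i≡fw = inj₁ (there (here i≡fw))
      ... | no i≢fℓ | no i≢fw = inj₂ (other-class-neighbour X∩Nw⊆z i i≢fℓ i≢fw)

  m≤1+maxDegree : 1 ≤ maxDegree G → m ≤ suc (maxDegree G)
  m≤1+maxDegree 1≤Δ with TwoDominating? G X
  ... | yes domX = ≤-trans (TwoDominating-leaf-class⇒m≤1 domX) (s≤s z≤n)
  ... | no ¬domX with ¬TwoDominating⇒∃ G ¬domX
  ...   | w , w∉X , sparse with pivot-neighbour G sparse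
  ...     | z , X∩Nw⊆z , bound =
    ≤-trans (m≤2+∣N-z∣ w∉X X∩Nw⊆z) (s≤s (≤-trans bound (⊔-lub (degree≤maxDegree G w) 1≤Δ)))

-- Trees

lastV∈ : ∀ {A : Set} (x : A) xs → lastV x xs ∈ₗ x ∷ xs
lastV∈ x [] = here refl
lastV∈ x (y ∷ ys) = there (lastV∈ y ys)

lastV-∷ʳ : ∀ {A : Set} (x : A) xs y → lastV x (xs ∷ʳ y) ≡ y
lastV-∷ʳ x [] y = refl
lastV-∷ʳ x (z ∷ zs) y = lastV-∷ʳ z zs y

Linked-∷ʳ : ∀ {A : Set} {R : A → A → Set} {x xs y} →
            Linked R (x ∷ xs) → R (lastV x xs) y → Linked R (x ∷ xs ∷ʳ y)
Linked-∷ʳ {xs = []} _ Rxy = Rxy ∷ [-]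
Linked-∷ʳ {xs = _ ∷ _} (Rxz ∷ Rzs) Rzy = Rxz ∷ Linked-∷ʳ Rzs Rzy

module _ (G : Graph) where

  _++ʷ_ : ∀ {u v w} → Walk G u v → Walk G v w → Walk G u w
  here _ ++ʷ q = q
  step u~x p ++ʷ q = step u~x (p ++ʷ q)

  reverseʷ : ∀ {u v} → Walk G u v → Walk G v u
  reverseʷ (here v) = here v
  reverseʷ (step u~x p) = reverseʷ p ++ʷ step (Adj-sym G u~x) (here _)

  Connected-via : ∀ r → (∀ u → Walk G u r) → Connected G
  Connected-via r to-r u v = to-r u ++ʷ reverseʷ (to-r v)

  open Cycle

  rotate : (C : Cycle G) → ∀ {x xs} → rest C ≡ x ∷ xs →
           Σ (Cycle G) λ C′ → first C′ ≡ x × rest C′ ≡ xs ∷ʳ first C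
  rotate record { first = x₀ ; long = long ; distinct = x₀∉ ∷ distinct
                ; path = x₀~x ∷ path ; closes = closes } {x} {xs} refl = C′ , refl , refl
    where
    C′ : Cycle G
    C′ = record
      { first = x
      ; rest = xs ∷ʳ x₀
      ; long = subst (λ l → 3 ≤ suc l) (sym (trans (length-++ xs) (+-comm (length xs) 1))) long
      ; distinct = ++⁺ distinct ([] ∷ []) (λ { (x₀∈ , here refl) → All.lookup x₀∉ x₀∈ refl })
      ; path = Linked-∷ʳ path closes
      ; closes = subst (λ y → Adj G y x) (sym (lastV-∷ʳ x xs x₀)) x₀~x
      }

  rotate-to : (C : Cycle G) → ∀ {v} → v ∈ₗ rest C → Σ (Cycle G) λ C′ → first C′ ≡ v
  rotate-to C v∈ with ∈-∃++ v∈
  ... | ys , zs , split = go ys C split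
    where
    go : ∀ {v zs} ys (C : Cycle G) → rest C ≡ ys ++ v ∷ zs → Σ (Cycle G) λ C′ → first C′ ≡ v
    go [] C split = let C′ , first≡ , _ = rotate C split in C′ , first≡
    go {v} {zs} (y ∷ ys) C split =
      let C′ , _ , rest≡ = rotate C split in go ys C′ (trans rest≡ (++-assoc ys (v ∷ zs) [ first C ]))

  cycle-neighbours : (C : Cycle G) → ∃ λ a → ∃ λ b →
    a ≢ b × Adj G (first C) a × Adj G (first C) b × a ∈ₗ rest C × b ∈ₗ rest C
  cycle-neighbours record { rest = [] ; long = s≤s () }
  cycle-neighbours record { rest = _ ∷ [] ; long = s≤s (s≤s ()) }
  cycle-neighbours record { rest = a ∷ b ∷ ys ; distinct = _ ∷ (a∉ ∷ _)
                          ; path = v~a ∷ _ ; closes = closes } =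
    a , lastV b ys , All.lookup a∉ (lastV∈ b ys) , v~a , Adj-sym G closes , here refl , there (lastV∈ b ys)

  -- Rotating a cycle to start at a cycle-neighbour of smaller rank descends forever.
  Acyclic-by-rank : (r : Fin (n G) → ℕ) →
    (∀ {v a b} → Adj G v a → Adj G v b → a ≢ b → r a < r v ⊎ r b < r v) → Acyclic G
  Acyclic-by-rank r descends C = no-cycle-below (suc (r (first C))) C ≤-refl
    where
    no-cycle-below : ∀ k (C : Cycle G) → ¬ r (first C) < k
    no-cycle-below (suc k) C r<k with cycle-neighbours C
    ... | a , b , a≢b , v~a , v~b , a∈ , b∈ = [ descend a∈ , descend b∈ ]′ (descends v~a v~b a≢b)
      where
      descend : ∀ {x} → x ∈ₗ rest C → ¬ r x < r (first C)
      descend x∈ rx<rv with rotate-to C x∈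
      ... | C′ , refl = no-cycle-below k C′ (≤-trans rx<rv (≤-pred r<k))

symClosure : (k : ℕ) (e : Fin k → Fin k → Bool) → (∀ v → e v v ≡ false) → Graph
symClosure k e e-irrefl = record
  { n = k
  ; adj = λ u v → e u v ∨ e v u
  ; sym = λ u v → ∨-comm (e u v) (e v u)
  ; irrefl = λ v → cong₂ _∨_ (e-irrefl v) (e-irrefl v)
  }

-- Reading e u v as "v is the parent of u": a vertex has at most one parent, so of two
-- distinct neighbours one is a child, of smaller rank.
Acyclic-symClosure : ∀ {k} (e : Fin k → Fin k → Bool) (e-irrefl : ∀ v → e v v ≡ false) (r : Fin k → ℕ) →
  (∀ {u v} → T (e u v) → r u < r v) → (∀ {u v w} → T (e u v) → T (e u w) → v ≡ w) →
  Acyclic (symClosure k e e-irrefl)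
Acyclic-symClosure {k} e e-irrefl r rank-grows parent-unique =
  Acyclic-by-rank (symClosure k e e-irrefl) r descends
  where
  descends : ∀ {v a b} → T (e v a ∨ e a v) → T (e v b ∨ e b v) → a ≢ b → r a < r v ⊎ r b < r v
  descends v~a v~b a≢b with Equivalence.to T-∨ v~a | Equivalence.to T-∨ v~b
  ... | inj₂ a→v | _ = inj₁ (rank-grows a→v)
  ... | inj₁ _ | inj₂ b→v = inj₂ (rank-grows b→v)
  ... | inj₁ v→a | inj₁ v→b = ⊥-elim (a≢b (parent-unique v→a v→b))

-- The path P₄ = 1 – 0 – 2 – 3, each edge oriented towards 0

pathEdge : Fin 4 → Fin 4 → Bool
pathEdge (suc zero) zero = true
pathEdge (suc (suc zero)) zero = true
pathEdge (suc (suc (suc zero))) (suc (suc zero)) = true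
pathEdge _ _ = false

pathEdge-irrefl : ∀ v → pathEdge v v ≡ false
pathEdge-irrefl zero = refl
pathEdge-irrefl (suc zero) = refl
pathEdge-irrefl (suc (suc zero)) = refl
pathEdge-irrefl (suc (suc (suc zero))) = refl

P₄ : Graph
P₄ = symClosure 4 pathEdge pathEdge-irrefl

IsTree-P₄ : IsTree P₄
IsTree-P₄ =
  s≤s z≤n , Connected-via P₄ zero to-0 ,
  Acyclic-symClosure pathEdge pathEdge-irrefl height height-grows parent-unique
  where
  to-0 : ∀ u → Walk P₄ u zero
  to-0 zero = here _
  to-0 (suc zero) = step _ (here _)
  to-0 (suc (suc zero)) = step _ (here _)
  to-0 (suc (suc (suc zero))) = step {w = suc (suc zero)} _ (step _ (here _))
  height : Fin 4 → ℕ
  height zero = 2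
  height (suc (suc zero)) = 1
  height _ = 0
  height-grows : ∀ {u v} → T (pathEdge u v) → height u < height v
  height-grows {suc zero} {zero} _ = s≤s z≤n
  height-grows {suc (suc zero)} {zero} _ = s≤s (s≤s z≤n)
  height-grows {suc (suc (suc zero))} {suc (suc zero)} _ = s≤s z≤n
  parent-unique : ∀ {u v w} → T (pathEdge u v) → T (pathEdge u w) → v ≡ w
  parent-unique {suc zero} {zero} {zero} _ _ = refl
  parent-unique {suc (suc zero)} {zero} {zero} _ _ = refl
  parent-unique {suc (suc (suc zero))} {suc (suc zero)} {suc (suc zero)} _ _ = refl

C₂-P₄ : C₂≡ P₄ 3
C₂-P₄ = (label , partnered⇒partition P₄ label surjective partner) ,
        λ m (_ , partition) → m≤1+maxDegree P₄ {ℓ = suc zero} (s≤s z≤n) partition (s≤s z≤n)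
  where
  label : Fin 4 → Fin 3
  label zero = suc zero
  label (suc zero) = zero
  label (suc (suc zero)) = suc (suc zero)
  label (suc (suc (suc zero))) = zero
  surjective : Surjective _≡_ _≡_ label
  surjective zero = suc zero , λ { refl → refl }
  surjective (suc zero) = zero , λ { refl → refl }
  surjective (suc (suc zero)) = suc (suc zero) , λ { refl → refl }
  coalition : ∀ i j → {True (TwoCoalition? P₄ (cls P₄ label i) (cls P₄ label j))} →
              TwoCoalition P₄ (cls P₄ label i) (cls P₄ label j)
  coalition i j {ok} = toWitness ok
  partner : ∀ i → Partnered P₄ label i
  partner zero = suc zero , (λ ()) , coalition zero (suc zero)
  partner (suc zero) = zero , (λ ()) , coalition (suc zero) zero
  partner (suc (suc zero)) = zero , (λ ()) , coalition (suc (suc zero)) zero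

-- Spiders: a centre with a pendant vertex and t spokes, each spoke carrying two leaves

≢1⇒2≤ : ∀ {k} → k ≢ 1 → Fin k → 2 ≤ k
≢1⇒2≤ {suc zero} k≢1 _ = ⊥-elim (k≢1 refl)
≢1⇒2≤ {suc (suc _)} _ _ = s≤s (s≤s z≤n)

data Node (t : ℕ) : Set where
  centre pendant : Node t
  spoke leafˡ leafʳ : Fin t → Node t

module Spider (t : ℕ) where

  size : ℕ
  size = 2 + (t + (t + t))

  encode : Node t → Fin size
  encode centre = zero
  encode pendant = suc zero
  encode (spoke i) = suc (suc (i ↑ˡ (t + t)))
  encode (leafˡ i) = suc (suc (t ↑ʳ (i ↑ˡ t)))
  encode (leafʳ i) = suc (suc (t ↑ʳ (t ↑ʳ i)))

  decode : Fin size → Node t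
  decode zero = centre
  decode (suc zero) = pendant
  decode (suc (suc v)) = [ spoke , (λ w → [ leafˡ , leafʳ ]′ (splitAt t w)) ]′ (splitAt t v)

  decode-encode : ∀ x → decode (encode x) ≡ x
  decode-encode centre = refl
  decode-encode pendant = refl
  decode-encode (spoke i) rewrite splitAt-↑ˡ t i (t + t) = refl
  decode-encode (leafˡ i) rewrite splitAt-↑ʳ t (t + t) (i ↑ˡ t) | splitAt-↑ˡ t i t = refl
  decode-encode (leafʳ i) rewrite splitAt-↑ʳ t (t + t) (t ↑ʳ i) | splitAt-↑ʳ t t i = refl

  encode-decode : ∀ v → encode (decode v) ≡ v
  encode-decode zero = refl
  encode-decode (suc zero) = refl
  encode-decode (suc (suc v)) with splitAt t v in split₁
  ... | inj₁ i = cong (λ v → suc (suc v)) (splitAt⁻¹-↑ˡ split₁)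
  ... | inj₂ w with splitAt t w in split₂
  ...   | inj₁ i =
    cong (λ v → suc (suc v)) (trans (cong (t ↑ʳ_) (splitAt⁻¹-↑ˡ split₂)) (splitAt⁻¹-↑ʳ split₁))
  ...   | inj₂ i =
    cong (λ v → suc (suc v)) (trans (cong (t ↑ʳ_) (splitAt⁻¹-↑ʳ split₂)) (splitAt⁻¹-↑ʳ split₁))

  encode-injective : ∀ {x y} → encode x ≡ encode y → x ≡ y
  encode-injective {x} {y} eq = trans (sym (decode-encode x)) (trans (cong decode eq) (decode-encode y))

  decode-injective : ∀ {u v} → decode u ≡ decode v → u ≡ v
  decode-injective {u} {v} eq = trans (sym (encode-decode u)) (trans (cong encode eq) (encode-decode v))

  isParent : Node t → Node t → Bool
  isParent pendant centre = true
  isParent (spoke _) centre = true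
  isParent (leafˡ j) (spoke i) = ⌊ i ≟F j ⌋
  isParent (leafʳ j) (spoke i) = ⌊ i ≟F j ⌋
  isParent _ _ = false

  isParent-irrefl : ∀ x → isParent x x ≡ false
  isParent-irrefl centre = refl
  isParent-irrefl pendant = refl
  isParent-irrefl (spoke _) = refl
  isParent-irrefl (leafˡ _) = refl
  isParent-irrefl (leafʳ _) = refl

  height : Node t → ℕ
  height centre = 2
  height (spoke _) = 1
  height _ = 0

  height-grows : ∀ {x y} → T (isParent x y) → height x < height y
  height-grows {pendant} {centre} _ = s≤s z≤n
  height-grows {spoke _} {centre} _ = s≤s (s≤s z≤n)
  height-grows {leafˡ _} {spoke _} _ = s≤s z≤n
  height-grows {leafʳ _} {spoke _} _ = s≤s z≤n

  parent-unique : ∀ {x y z} → T (isParent x y) → T (isParent x z) → y ≡ z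
  parent-unique {pendant} {centre} {centre} _ _ = refl
  parent-unique {spoke _} {centre} {centre} _ _ = refl
  parent-unique {leafˡ _} {spoke _} {spoke _} i≡j i′≡j =
    cong spoke (trans (toWitness i≡j) (sym (toWitness i′≡j)))
  parent-unique {leafʳ _} {spoke _} {spoke _} i≡j i′≡j =
    cong spoke (trans (toWitness i≡j) (sym (toWitness i′≡j)))

  spiderEdge : Fin size → Fin size → Bool
  spiderEdge u v = isParent (decode u) (decode v)

  spider : Graph
  spider = symClosure size spiderEdge (isParent-irrefl ∘ decode)

  _~_ : Node t → Node t → Set
  x ~ y = T (isParent x y ∨ isParent y x)

  ~-sym : ∀ {x y} → x ~ y → y ~ x
  ~-sym {x} {y} = subst T (∨-comm (isParent x y) (isParent y x))

  ~⇒Adj : ∀ {x y} → x ~ y → Adj spider (encode x) (encode y)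
  ~⇒Adj {x} {y} = subst₂ _~_ (sym (decode-encode x)) (sym (decode-encode y))

  ∈N⇒~ : ∀ {x v} → v ∈ N spider (encode x) → x ~ decode v
  ∈N⇒~ {x} {v} v∈ = subst (_~ decode v) (decode-encode x) (∈N⇒Adj spider {encode x} v∈)

  walk-to-centre : ∀ x → Walk spider (encode x) (encode centre)
  walk-to-centre centre = here _
  walk-to-centre pendant = step (~⇒Adj {pendant} {centre} _) (here _)
  walk-to-centre (spoke i) = step (~⇒Adj {spoke i} {centre} _) (here _)
  walk-to-centre (leafˡ i) =
    step (~⇒Adj {leafˡ i} {spoke i} (~-sym {spoke i} {leafˡ i} (fromWitness refl))) (walk-to-centre (spoke i))
  walk-to-centre (leafʳ i) =
    step (~⇒Adj {leafʳ i} {spoke i} (~-sym {spoke i} {leafʳ i} (fromWitness refl))) (walk-to-centre (spoke i))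

  IsTree-spider : IsTree spider
  IsTree-spider =
    s≤s z≤n ,
    Connected-via spider (encode centre)
      (λ u → subst (λ u → Walk spider u _) (encode-decode u) (walk-to-centre (decode u))) ,
    Acyclic-symClosure spiderEdge (isParent-irrefl ∘ decode) (height ∘ decode)
      (λ {u} → height-grows {decode u}) (λ {u} p q → decode-injective (parent-unique {decode u} p q))

  degree≤length : ∀ x (ys : List (Node t)) → (∀ {y} → x ~ y → y ∈ₗ ys) →
                  degree spider (encode x) ≤ length ys
  degree≤length x ys covers = subst (degree spider (encode x) ≤_) (length-map encode ys)
    (∣p∣≤length _ (map encode ys) λ {v} v∈ →
      subst (_∈ₗ _) (encode-decode v) (∈-map⁺ encode (covers (∈N⇒~ v∈))))

  length≤degree : ∀ x (ys : List (Node t)) → Unique ys → All (x ~_) ys →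
                  length ys ≤ degree spider (encode x)
  length≤degree x ys ys! x~ys = subst (_≤ degree spider (encode x)) (length-map encode ys)
    (length≤∣p∣ _ (map encode ys) (Unique-map⁺ encode-injective ys!)
      (All.map⁺ (All.map (λ {y} x~y → Adj⇒∈N spider {encode x} {encode y} (~⇒Adj {x} {y} x~y)) x~ys)))

  degree-centre : degree spider (encode centre) ≡ suc t
  degree-centre = ≤-antisym
    (subst (degree spider (encode centre) ≤_) length-neighbours (degree≤length centre neighbours covers))
    (subst (_≤ degree spider (encode centre)) length-neighbours
      (length≤degree centre neighbours neighbours! adjacent))
    where
    neighbours : List (Node t)
    neighbours = pendant ∷ map spoke (allFin t)
    length-neighbours : length neighbours ≡ suc t
    length-neighbours = cong suc (trans (length-map spoke (allFin t)) (length-tabulate _))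
    covers : ∀ {y} → centre ~ y → y ∈ₗ neighbours
    covers {pendant} _ = here refl
    covers {spoke i} _ = there (∈-map⁺ spoke (∈-allFin i))
    neighbours! : Unique neighbours
    neighbours! = All.map⁺ (All.tabulate (λ _ ())) ∷ Unique-map⁺ (λ { refl → refl }) (allFin⁺ t)
    adjacent : All (centre ~_) neighbours
    adjacent = _ ∷ All.map⁺ (All.tabulate (λ _ → _))

  degree-pendant : degree spider (encode pendant) ≤ 1
  degree-pendant = degree≤length pendant [ centre ] λ { {centre} _ → here refl }

  degree≤1+t : t ≢ 1 → ∀ x → degree spider (encode x) ≤ suc t
  degree≤1+t _ centre = ≤-reflexive degree-centre
  degree≤1+t _ pendant = ≤-trans degree-pendant (s≤s z≤n)
  degree≤1+t t≢1 (spoke i) =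
    ≤-trans (degree≤length (spoke i) (centre ∷ leafˡ i ∷ leafʳ i ∷ []) covers) (s≤s (≢1⇒2≤ t≢1 i))
    where
    covers : ∀ {y} → spoke i ~ y → y ∈ₗ centre ∷ leafˡ i ∷ leafʳ i ∷ []
    covers {centre} _ = here refl
    covers {leafˡ j} i≡j = there (here (cong leafˡ (sym (toWitness i≡j))))
    covers {leafʳ j} i≡j = there (there (here (cong leafʳ (sym (toWitness i≡j)))))
  degree≤1+t _ (leafˡ i) = ≤-trans (degree≤length (leafˡ i) [ spoke i ] covers) (s≤s z≤n)
    where
    covers : ∀ {y} → leafˡ i ~ y → y ∈ₗ [ spoke i ]
    covers {spoke j} j≡i = here (cong spoke (toWitness (~-sym {leafˡ i} {spoke j} j≡i)))
  degree≤1+t _ (leafʳ i) = ≤-trans (degree≤length (leafʳ i) [ spoke i ] covers) (s≤s z≤n)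
    where
    covers : ∀ {y} → leafʳ i ~ y → y ∈ₗ [ spoke i ]
    covers {spoke j} j≡i = here (cong spoke (toWitness (~-sym {leafʳ i} {spoke j} j≡i)))

  maxDegree-spider : t ≢ 1 → maxDegree spider ≡ suc t
  maxDegree-spider t≢1 = ≤-antisym
    (maxDegree≤ spider λ v →
      subst (λ v → degree spider v ≤ suc t) (encode-decode v) (degree≤1+t t≢1 (decode v)))
    (subst (_≤ maxDegree spider) degree-centre (degree≤maxDegree spider (encode centre)))

  TwoDominating-spider : ∀ S →
    (∀ x → encode x ∉ S → ∃ λ a → ∃ λ b → a ≢ b × encode a ∈ S × encode b ∈ S × x ~ a × x ~ b) →
    TwoDominating spider S
  TwoDominating-spider S neighbours = TwoDominating-by-neighbours spider S λ v v∉S →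
    let x = decode v
        a , b , a≢b , a∈S , b∈S , x~a , x~b = neighbours x (subst (_∉ S) (sym (encode-decode v)) v∉S)
        from-v : ∀ {y} → x ~ y → Adj spider v (encode y)
        from-v {y} x~y = subst (λ u → Adj spider u (encode y)) (encode-decode v) (~⇒Adj {x} {y} x~y)
    in encode a , encode b , a≢b ∘ encode-injective , a∈S , b∈S , from-v x~a , from-v x~b

  ¬TwoDominating-spider : ∀ S x z → encode x ∉ S → (∀ {y} → encode y ∈ S → x ~ y → y ≡ z) →
    ¬ TwoDominating spider S
  ¬TwoDominating-spider S x z x∉S only-z dom = 1+n≰n (≤-trans (dom (encode x) x∉S) (⊆⁅x⁆⇒∣p∣≤1 ⊆z))
    where
    ⊆z : S ∩ N spider (encode x) ⊆ ⁅ encode z ⁆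
    ⊆z {v} v∈ with x∈p∩q⁻ S (N spider (encode x)) v∈
    ... | v∈S , v∈N =
      subst (_∈ ⁅ encode z ⁆) (trans (cong encode (sym y≡z)) (encode-decode v)) (x∈⁅x⁆ (encode z))
      where
      y≡z : decode v ≡ z
      y≡z = only-z (subst (_∈ S) (sym (encode-decode v)) v∈S) (∈N⇒~ v∈N)

  label : Node t → Fin (2 + t)
  label centre = suc zero
  label (spoke i) = suc (suc i)
  label _ = zero

  classOf : Fin size → Fin (2 + t)
  classOf = label ∘ decode

  Class : Fin (2 + t) → Subset size
  Class = cls spider classOf

  ∈Class⁺ : ∀ y {i} → label y ≡ i → encode y ∈ Class i
  ∈Class⁺ y label≡i = ∈cls⁺ spider classOf (trans (cong label (decode-encode y)) label≡i)

  ∈Class⁻ : ∀ y {i} → encode y ∈ Class i → label y ≡ i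
  ∈Class⁻ y y∈ = trans (cong label (sym (decode-encode y))) (∈cls⁻ spider classOf y∈)

  ¬TwoDominating-Class₀ : ¬ TwoDominating spider (Class zero)
  ¬TwoDominating-Class₀ =
    ¬TwoDominating-spider (Class zero) centre pendant (λ c∈ → case ∈Class⁻ centre c∈ of λ ()) only-pendant
    where
    only-pendant : ∀ {y} → encode y ∈ Class zero → centre ~ y → y ≡ pendant
    only-pendant {pendant} _ _ = refl
    only-pendant {spoke i} y∈ _ = case ∈Class⁻ (spoke i) y∈ of λ ()

  ¬TwoDominating-Class : ∀ i → i ≢ zero → ¬ TwoDominating spider (Class i)
  ¬TwoDominating-Class i i≢0 =
    ¬TwoDominating-spider (Class i) pendant centre (λ p∈ → i≢0 (sym (∈Class⁻ pendant p∈))) only-centre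
    where
    only-centre : ∀ {y} → encode y ∈ Class i → pendant ~ y → y ≡ centre
    only-centre {centre} _ _ = refl

  ∈Class∪⁺ˡ : ∀ y {i j} → label y ≡ i → encode y ∈ Class i ∪ Class j
  ∈Class∪⁺ˡ y = x∈p∪q⁺ ∘ inj₁ ∘ ∈Class⁺ y

  ∈Class∪⁺ʳ : ∀ y {i j} → label y ≡ j → encode y ∈ Class i ∪ Class j
  ∈Class∪⁺ʳ y = x∈p∪q⁺ ∘ inj₂ ∘ ∈Class⁺ y

  dominated : ∀ i → i ≢ zero → ∀ x → encode x ∉ Class i ∪ Class zero →
    ∃ λ a → ∃ λ b → a ≢ b × encode a ∈ Class i ∪ Class zero × encode b ∈ Class i ∪ Class zero ×
                    x ~ a × x ~ b
  dominated zero i≢0 _ _ = ⊥-elim (i≢0 refl)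
  dominated (suc zero) _ centre c∉ = ⊥-elim (c∉ (∈Class∪⁺ˡ centre refl))
  dominated (suc (suc r)) _ centre _ =
    pendant , spoke r , (λ ()) , ∈Class∪⁺ʳ pendant refl , ∈Class∪⁺ˡ (spoke r) refl , _ , _
  dominated _ _ (spoke s) _ =
    leafˡ s , leafʳ s , (λ ()) , ∈Class∪⁺ʳ (leafˡ s) refl , ∈Class∪⁺ʳ (leafʳ s) refl ,
    fromWitness refl , fromWitness refl
  dominated _ _ pendant p∉ = ⊥-elim (p∉ (∈Class∪⁺ʳ pendant refl))
  dominated _ _ (leafˡ s) l∉ = ⊥-elim (l∉ (∈Class∪⁺ʳ (leafˡ s) refl))
  dominated _ _ (leafʳ s) l∉ = ⊥-elim (l∉ (∈Class∪⁺ʳ (leafʳ s) refl))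

  TwoDominating-Class∪Class₀ : ∀ i → i ≢ zero → TwoDominating spider (Class i ∪ Class zero)
  TwoDominating-Class∪Class₀ i i≢0 = TwoDominating-spider (Class i ∪ Class zero) (dominated i i≢0)

  partner : ∀ i → Partnered spider classOf i
  partner zero = suc zero , (λ ()) , ¬TwoDominating-Class₀ , ¬TwoDominating-Class (suc zero) (λ ()) ,
    subst (TwoDominating spider) (∪-comm (Class (suc zero)) (Class zero))
      (TwoDominating-Class∪Class₀ (suc zero) (λ ()))
  partner (suc i) = zero , (λ ()) , ¬TwoDominating-Class (suc i) (λ ()) , ¬TwoDominating-Class₀ ,
    TwoDominating-Class∪Class₀ (suc i) (λ ())

  classOf-surjective : Surjective _≡_ _≡_ classOf
  classOf-surjective zero = encode pendant , λ { refl → refl }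
  classOf-surjective (suc zero) = encode centre , λ { refl → refl }
  classOf-surjective (suc (suc i)) = encode (spoke i) , λ { refl → cong label (decode-encode (spoke i)) }

  C₂-spider : t ≢ 1 → C₂≡ spider (2 + t)
  C₂-spider t≢1 = (classOf , partnered⇒partition spider classOf classOf-surjective partner) , bounded
    where
    bounded : ∀ m → HasTwoCoalitionPartition spider m → m ≤ 2 + t
    bounded m (_ , partition) = subst (λ Δ → m ≤ suc Δ) (maxDegree-spider t≢1)
      (m≤1+maxDegree spider {ℓ = encode pendant} degree-pendant partition
        (subst (1 ≤_) (sym (maxDegree-spider t≢1)) (s≤s z≤n)))

corollary4 : (k : ℕ) → 1 ≤ k →
    Σ Graph λ T → IsTree T × maxDegree T ≡ k × C₂≡ T (suc k)
corollary4 (suc zero) _ = spider , IsTree-spider , maxDegree-spider (λ ()) , C₂-spider (λ ())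
  where open Spider 0
corollary4 (suc (suc zero)) _ = P₄ , IsTree-P₄ , refl , C₂-P₄
corollary4 (suc (suc (suc s))) _ = spider , IsTree-spider , maxDegree-spider (λ ()) , C₂-spider (λ ())
  where open Spider (suc (suc s))
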